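{- Let $N\geq n>t$ be positive integers with $n\geq 3$, and let $I=\{1,2\}$. If the coloring $c:[N]^{(2)}\to\{0,1\}$ contains no monochromatic complete graph $K_t^{(2)}$, then the induced coloring $\chi_c:[2^N]^{(3)}\to\mathbb{Z}_4$ (a) contains no monochromatic copy of any member of $\mathcal{F}_I^{(3)}(n)$ in color $0$ or in color $1$, and (b) contains no monochromatic copy of any member of $\mathrm{rev}\,\mathcal{F}_I^{(3)}(n)$ in color $2$ or in color $3$.
   Context: Identify each $x\in[2^N]$ with the binary string of length $N$ representing $x-1$ (leaves, in left-to-right order, of the complete binary tree of height $N$, levels numbered $1$ at the root to $N+1$ at the leaves). For distinct $x,y$, $\delta(x,y)$ is one plus the length of the longest common prefix of their strings (the level of their greatest common ancestor). For $X=\{x_1<x_2<x_3\}$, $\pi(X)=\{\delta(x_1,x_2),\delta(x_2,x_3)\}$ (a 2-element set); $X$ is a left comb if $\delta(x_1,x_2)>\delta(x_2,x_3)$ and a right comb if $\delta(x_1,x_2)<\delta(x_2,x_3)$. The induced coloring is $\chi_c(X)=c(\pi(X))$ if $X$ is a left comb and $\chi_c(X)=3-c(\pi(X))$ if $X$ is a right comb. An ordered $k$-graph $(F,<)$ is a $k$-uniform hypergraph with a linear order on its vertices, considered up to order-preserving isomorphism. A coloring $\chi$ of $[M]^{(k)}$ contains a monochromatic copy of $(F,<)$ in color $\alpha$ if there is an order-preserving injection $\varphi:V(F)\to[M]$ with $\chi(\varphi(e))=\alpha$ for all edges $e$. For $k,n\geq 3$ and $I\in[n]^{(k-1)}$ with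 $1\in I$, $\mathcal{F}_I^{(k)}(n)$ is the family of ordered $k$-graphs $(F,<)$ with $V(F)=\{x_0,\dots,x_n\}\cup\{x_J:J\in\{2,\dots,n\}^{(k-1)}\cup\{I\}\}$, where $x_0<x_1<\dots<x_n$ are distinct, $x_I=x_0$, and $x_0\leq x_J\leq x_1$ for each $J\in\{2,\dots,n\}^{(k-1)}$ (distinct $J$ may give the same vertex, and $x_J$ may equal $x_0$ or $x_1$), with edge set $\{\{x_J\}\cup\{x_j:j\in J\}:J\in\{2,\dots,n\}^{(k-1)}\cup\{I\}\}$. $\mathrm{rev}\,\mathcal{F}_I^{(k)}(n)$ consists of the same hypergraphs with the reversed vertex order. -}

module Defs where

open import Data.Nat using (ℕ; zero; suc; _+_; _∸_; _^_; _≤_; _<_; _/_; _%_; _<ᵇ_)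
open import Data.Nat.Properties using (_≟_; m^n≢0)
open import Data.Fin using (Fin; toℕ)
open import Data.Bool using (Bool; true; false; if_then_else_)
open import Data.Product using (Σ; ∃; _×_; _,_)
open import Data.Sum using (_⊎_)
open import Relation.Nullary.Decidable using (⌊_⌋)
open import Relation.Binary.PropositionalEquality using (_≡_)

-- A vertex x ∈ [2^N] is represented by the natural number v = x - 1,
-- 0 ≤ v < 2^N, whose N-bit binary expansion (most significant bit first)
-- is the string of x.  The order of leaves is the numeric order of v.

lcp : ℕ → ℕ → ℕ → ℕ
lcp zero    a b = 0
lcp (suc N) a b =
  if ⌊ (a / 2 ^ N) ≟ (b / 2 ^ N) ⌋
  then suc (lcp N (a % 2 ^ N) (b % 2 ^ N))
  else 0
  where instance _ = m^n≢0 2 N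

-- δ(x,y) = 1 + length of the longest common prefix (level of the gca)
δ : ℕ → ℕ → ℕ → ℕ
δ N a b = suc (lcp N a b)

-- A 2-coloring of pairs of [N]: c i j is the colour of {i,j}, used for i < j.
Col2 : Set
Col2 = ℕ → ℕ → Fin 2

-- Induced colouring χ_c of triples x1 < x2 < x3 of leaves, colours in ℤ₄
-- represented by 0,1,2,3.  Left comb (δ12 > δ23): c(π X);
-- right comb (δ12 < δ23): 3 - c(π X).  (δ12 ≠ δ23 always holds for
-- x1 < x2 < x3; the equal case never arises.)
χ : (N : ℕ) → Col2 → ℕ → ℕ → ℕ → ℕ
χ N c x₁ x₂ x₃ =
  let d₁ = δ N x₁ x₂
      d₂ = δ N x₂ x₃
  in if d₂ <ᵇ d₁ then toℕ (c d₂ d₁) else 3 ∸ toℕ (c d₁ d₂)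

MonoClique : (N t : ℕ) → Col2 → Fin 2 → Set
MonoClique N t c α =
  Σ (ℕ → ℕ) λ f →
    (∀ i → i < t → 1 ≤ f i × f i ≤ N) ×
    (∀ i j → i < j → j < t → f i < f j) ×
    (∀ i j → i < j → j < t → c (f i) (f j) ≡ α)

-- The ordered vertex set is a finite set of natural numbers with their
-- usual order: x 0 < x 1 < … < x n, and for each J = {j < j'} ⊆ {2,…,n}
-- a vertex xJ j j' with x 0 ≤ xJ j j' ≤ x 1 (possibly coinciding with each
-- other or with x 0, x 1); x_I = x 0.
-- Edges: {x 0, x 1, x 2} (for J = I) and {xJ j j', x j, x j'}.

ValidJ : ℕ → ℕ → ℕ → Set
ValidJ n j j' = 2 ≤ j × j < j' × j' ≤ n

record FMember (n : ℕ) : Set where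
  field
    x      : ℕ → ℕ
    xJ     : ℕ → ℕ → ℕ
    x-mono : ∀ i j → i < j → j ≤ n → x i < x j
    xJ-lo  : ∀ j j' → ValidJ n j j' → x 0 ≤ xJ j j'
    xJ-hi  : ∀ j j' → ValidJ n j j' → xJ j j' ≤ x 1

module _ {n : ℕ} (F : FMember n) where
  open FMember F

  IsVertex : ℕ → Set
  IsVertex v = (Σ ℕ λ i → i ≤ n × v ≡ x i)
             ⊎ (Σ ℕ λ j → Σ ℕ λ j' → ValidJ n j j' × v ≡ xJ j j')

  MonoCopy : (N : ℕ) → Col2 → ℕ → Set
  MonoCopy N c α =
    Σ (ℕ → ℕ) λ φ →
      (∀ v → IsVertex v → φ v < 2 ^ N) ×
      (∀ u v → IsVertex u → IsVertex v → u < v → φ u < φ v) ×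
      (χ N c (φ (x 0)) (φ (x 1)) (φ (x 2)) ≡ α) ×
      (∀ j j' → ValidJ n j j' → χ N c (φ (xJ j j')) (φ (x j)) (φ (x j')) ≡ α)

  -- monochromatic copy of the member of rev 𝓕 (same hypergraph, reversed
  -- order): φ is order-reversing w.r.t. the original order, so each edge
  -- {xJ, x j, x j'} lands as the increasing triple φ(x j') < φ(x j) < φ(xJ).
  MonoCopyRev : (N : ℕ) → Col2 → ℕ → Set
  MonoCopyRev N c α =
    Σ (ℕ → ℕ) λ φ →
      (∀ v → IsVertex v → φ v < 2 ^ N) ×
      (∀ u v → IsVertex u → IsVertex v → u < v → φ v < φ u) ×
      (χ N c (φ (x 2)) (φ (x 1)) (φ (x 0)) ≡ α) ×
      (∀ j j' → ValidJ n j j' → χ N c (φ (x j')) (φ (x j)) (φ (xJ j j')) ≡ α)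

{-# OPTIONS --safe #-}
-- In a copy of colour γ ∈ {0, 1} every edge is a left comb. Let aᵢ be the image of xᵢ and y
-- that of some x_J. Since a₀ ≤ y ≤ a₁, the left comb on the edge I gives
-- δ(y, a₁) ≥ δ(a₀, a₁) > δ(a₁, a₂), and as δ is an ultrametric along the leaf order,
-- δ(y, aₚ) = δ(a₁, aₚ) for every p ≥ 2. For J = {p < q} the left comb on {y, aₚ, a_q} then
-- has levels δ(a₁, a_q) < δ(a₁, aₚ) and colour γ = c(δ(a₁, a_q), δ(a₁, aₚ)), so the levels
-- δ(a₁, aₚ), 2 ≤ p ≤ n, span a K_{n-1} of colour γ in c.
-- Reflecting the tree reverses the order of the leaves, keeps δ and swaps left and right
-- combs (δ never ties on three increasing leaves), so it turns χ_c into 3 − χ_c and a copy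
-- of a member of rev 𝓕 in colour 3 − γ into a copy of a member of 𝓕 in colour γ.
module Submission where

open import Data.Bool using (true; false; if_then_else_; T)
open import Data.Empty using (⊥-elim)
open import Data.Fin using (Fin; zero; suc; toℕ)
open import Data.Fin.Properties using (toℕ-injective)
open import Data.Nat
open import Data.Nat.Divisibility using (n∣m*n)
open import Data.Nat.DivMod
open import Data.Nat.Properties
open import Data.Product using (_×_; _,_; proj₁; proj₂)
open import Data.Sum using (inj₁; inj₂)
open import Data.Unit using (tt)
open import Relation.Binary using (tri<; tri≈; tri>)
open import Relation.Binary.PropositionalEquality
  using (_≡_; _≢_; refl; sym; trans; cong; cong₂; subst; subst₂; module ≡-Reasoning)
open import Relation.Nullary using (¬_; yes; no)
open import Relation.Nullary.Decidable using (⌊_⌋)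
open import Function using (_∘_)
open import Defs

module _ {m : ℕ} .{{_ : NonZero m}} {a b : ℕ} (same : a / m ≡ b / m) where
  open ≤-Reasoning

  /≡⇒%-mono-≤ : a ≤ b → a % m ≤ b % m
  /≡⇒%-mono-≤ a≤b = begin
    a % m         ≡⟨ m%n≡m∸m/n*n a m ⟩
    a ∸ a / m * m ≤⟨ ∸-monoˡ-≤ (a / m * m) a≤b ⟩
    b ∸ a / m * m ≡⟨ cong (λ q → b ∸ q * m) same ⟩
    b ∸ b / m * m ≡⟨ m%n≡m∸m/n*n b m ⟨
    b % m         ∎

  /≡⇒%-mono-< : a < b → a % m < b % m
  /≡⇒%-mono-< a<b = begin-strict
    a % m         ≡⟨ m%n≡m∸m/n*n a m ⟩
    a ∸ a / m * m <⟨ ∸-monoˡ-< a<b (m/n*n≤m a m) ⟩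
    b ∸ a / m * m ≡⟨ cong (λ q → b ∸ q * m) same ⟩
    b ∸ b / m * m ≡⟨ m%n≡m∸m/n*n b m ⟨
    b % m         ∎

lcp-min : ∀ N {u v w} → u ≤ v → v ≤ w → lcp N u w ≡ lcp N u v ⊓ lcp N v w
lcp-min zero    _   _   = refl
lcp-min (suc N) {u} {v} {w} u≤v v≤w
  with u / 2 ^ N ≟ w / 2 ^ N | u / 2 ^ N ≟ v / 2 ^ N | v / 2 ^ N ≟ w / 2 ^ N
  where instance _ = m^n≢0 2 N
... | yes _   | yes u~v | yes v~w =
  cong suc (lcp-min N (/≡⇒%-mono-≤ u~v u≤v) (/≡⇒%-mono-≤ v~w v≤w))
  where instance _ = m^n≢0 2 N
... | yes u~w | yes u~v | no v≁w  = ⊥-elim (v≁w (trans (sym u~v) u~w))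
... | yes u~w | no u≁v  | yes v~w = ⊥-elim (u≁v (trans u~w (sym v~w)))
... | yes u~w | no u≁v  | no _    = ⊥-elim (u≁v (≤-antisym (/-monoˡ-≤ (2 ^ N) u≤v)
                                      (subst (v / 2 ^ N ≤_) (sym u~w) (/-monoˡ-≤ (2 ^ N) v≤w))))
  where instance _ = m^n≢0 2 N
... | no u≁w  | yes u~v | yes v~w = ⊥-elim (u≁w (trans u~v v~w))
... | no _    | yes _   | no _    = refl
... | no _    | no _    | _       = refl

lcp-≢ : ∀ N {u v w} → u < v → v < w → w < 2 ^ N → lcp N u v ≢ lcp N v w
lcp-≢ zero    _   v<w w<1 = ⊥-elim (n≮0 (<-≤-trans v<w (≤-pred w<1)))
lcp-≢ (suc N) {u} {v} {w} u<v v<w w<2^N with u / 2 ^ N ≟ v / 2 ^ N | v / 2 ^ N ≟ w / 2 ^ N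
  where instance _ = m^n≢0 2 N
... | yes u~v | yes v~w = λ eq →
  lcp-≢ N (/≡⇒%-mono-< u~v u<v) (/≡⇒%-mono-< v~w v<w) (m%n<n w (2 ^ N)) (suc-injective eq)
  where instance _ = m^n≢0 2 N
... | yes _   | no _    = λ ()
... | no _    | yes _   = λ ()
... | no u≁v  | no v≁w  = λ _ → <⇒≱ (m<n*o⇒m/o<n {o = 2 ^ N} w<2^N) 2≤w/2^N
  where
  instance _ = m^n≢0 2 N
  u/2^N<v/2^N : u / 2 ^ N < v / 2 ^ N
  u/2^N<v/2^N = ≤∧≢⇒< (/-monoˡ-≤ (2 ^ N) (<⇒≤ u<v)) u≁v
  v/2^N<w/2^N : v / 2 ^ N < w / 2 ^ N
  v/2^N<w/2^N = ≤∧≢⇒< (/-monoˡ-≤ (2 ^ N) (<⇒≤ v<w)) v≁w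
  2≤w/2^N : 2 ≤ w / 2 ^ N
  2≤w/2^N = ≤-trans (s≤s (≤-trans z<s u/2^N<v/2^N)) v/2^N<w/2^N

lcp-< : ∀ N {a b} → a < b → b < 2 ^ N → lcp N a b < N
lcp-< zero    a<b b<1 = ⊥-elim (n≮0 (<-≤-trans a<b (≤-pred b<1)))
lcp-< (suc N) {a} {b} a<b b<2^N with a / 2 ^ N ≟ b / 2 ^ N
  where instance _ = m^n≢0 2 N
... | yes a~b = s≤s (lcp-< N (/≡⇒%-mono-< a~b a<b) (m%n<n b (2 ^ N)))
  where instance _ = m^n≢0 2 N
... | no _    = s≤s z≤n

module _ {m : ℕ} .{{_ : NonZero m}} {r q : ℕ} (r<m : r < m) where

  [r+q*m]/m≡q : (r + q * m) / m ≡ q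
  [r+q*m]/m≡q = begin
    (r + q * m) / m   ≡⟨ +-distrib-/-∣ʳ r (n∣m*n q) ⟩
    r / m + q * m / m ≡⟨ cong₂ _+_ (m<n⇒m/n≡0 r<m) (m*n/n≡m q m) ⟩
    q                 ∎
    where open ≡-Reasoning

  [r+q*m]%m≡r : (r + q * m) % m ≡ r
  [r+q*m]%m≡r = trans ([m+kn]%n≡m%n r q m) (m<n⇒m%n≡m r<m)

-- The leaf whose binary string is the complement of that of a.
mirror : ℕ → ℕ → ℕ
mirror N a = 2 ^ N ∸ suc a

mirror-< : ∀ N {a} → a < 2 ^ N → mirror N a < 2 ^ N
mirror-< N a<2^N = ∸-monoʳ-< z<s a<2^N

mirror-reverses : ∀ N {a b} → a < b → b < 2 ^ N → mirror N b < mirror N a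
mirror-reverses N a<b b<2^N = ∸-monoʳ-< (s≤s a<b) b<2^N

mirror-suc : ∀ N {r q} → r < 2 ^ N → q ≤ 1 →
  mirror (suc N) (r + q * 2 ^ N) ≡ mirror N r + (1 ∸ q) * 2 ^ N
mirror-suc N {r} r<m z≤n = begin
  2 * m ∸ suc (r + 0)   ≡⟨ cong (λ k → 2 * m ∸ suc k) (+-identityʳ r) ⟩
  (m + 1 * m) ∸ suc r   ≡⟨ +-∸-comm (1 * m) r<m ⟩
  (m ∸ suc r) + 1 * m   ∎
  where open ≡-Reasoning; m = 2 ^ N
mirror-suc N {r} r<m (s≤s z≤n) = begin
  (m + 1 * m) ∸ (suc r + 1 * m) ≡⟨ cong₂ _∸_ (+-comm m (1 * m)) (+-comm (suc r) (1 * m)) ⟩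
  (1 * m + m) ∸ (1 * m + suc r) ≡⟨ [m+n]∸[m+o]≡n∸o (1 * m) m (suc r) ⟩
  m ∸ suc r                     ≡⟨ +-identityʳ (m ∸ suc r) ⟨
  (m ∸ suc r) + 0 * m           ∎
  where open ≡-Reasoning; m = 2 ^ N

module _ (N : ℕ) {a : ℕ} (a<2^1+N : a < 2 ^ suc N) where
  private instance _ = m^n≢0 2 N

  a/2^N≤1 : a / 2 ^ N ≤ 1
  a/2^N≤1 = ≤-pred (m<n*o⇒m/o<n a<2^1+N)

  mirror-digits : mirror (suc N) a ≡ mirror N (a % 2 ^ N) + (1 ∸ a / 2 ^ N) * 2 ^ N
  mirror-digits = trans (cong (mirror (suc N)) (m≡m%n+[m/n]*n a (2 ^ N)))
                        (mirror-suc N (m%n<n a (2 ^ N)) a/2^N≤1)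

  mirror-/ : mirror (suc N) a / 2 ^ N ≡ 1 ∸ a / 2 ^ N
  mirror-/ = trans (cong (_/ 2 ^ N) mirror-digits)
                   ([r+q*m]/m≡q {q = 1 ∸ a / 2 ^ N} (mirror-< N (m%n<n a (2 ^ N))))

  mirror-% : mirror (suc N) a % 2 ^ N ≡ mirror N (a % 2 ^ N)
  mirror-% = trans (cong (_% 2 ^ N) mirror-digits)
                   ([r+q*m]%m≡r {q = 1 ∸ a / 2 ^ N} (mirror-< N (m%n<n a (2 ^ N))))

⌊1∸≟1∸⌋ : ∀ {x y} → x ≤ 1 → y ≤ 1 → ⌊ 1 ∸ x ≟ 1 ∸ y ⌋ ≡ ⌊ y ≟ x ⌋
⌊1∸≟1∸⌋ z≤n       z≤n       = refl
⌊1∸≟1∸⌋ z≤n       (s≤s z≤n) = refl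
⌊1∸≟1∸⌋ (s≤s z≤n) z≤n       = refl
⌊1∸≟1∸⌋ (s≤s z≤n) (s≤s z≤n) = refl

lcp-mirror : ∀ N {a b} → a < 2 ^ N → b < 2 ^ N → lcp N (mirror N a) (mirror N b) ≡ lcp N b a
lcp-mirror zero    _     _     = refl
lcp-mirror (suc N) {a} {b} a<2^1+N b<2^1+N =
  cong₂ (λ same l → if same then suc l else 0) sameBlock sameLcp
  where
  open ≡-Reasoning
  instance _ = m^n≢0 2 N
  sameBlock : ⌊ mirror (suc N) a / 2 ^ N ≟ mirror (suc N) b / 2 ^ N ⌋
            ≡ ⌊ b / 2 ^ N ≟ a / 2 ^ N ⌋
  sameBlock = begin
    ⌊ mirror (suc N) a / 2 ^ N ≟ mirror (suc N) b / 2 ^ N ⌋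
      ≡⟨ cong₂ (λ x y → ⌊ x ≟ y ⌋) (mirror-/ N a<2^1+N) (mirror-/ N b<2^1+N) ⟩
    ⌊ 1 ∸ a / 2 ^ N ≟ 1 ∸ b / 2 ^ N ⌋
      ≡⟨ ⌊1∸≟1∸⌋ (a/2^N≤1 N a<2^1+N) (a/2^N≤1 N b<2^1+N) ⟩
    ⌊ b / 2 ^ N ≟ a / 2 ^ N ⌋ ∎
  sameLcp : lcp N (mirror (suc N) a % 2 ^ N) (mirror (suc N) b % 2 ^ N)
          ≡ lcp N (b % 2 ^ N) (a % 2 ^ N)
  sameLcp = begin
    lcp N (mirror (suc N) a % 2 ^ N) (mirror (suc N) b % 2 ^ N)
      ≡⟨ cong₂ (lcp N) (mirror-% N a<2^1+N) (mirror-% N b<2^1+N) ⟩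
    lcp N (mirror N (a % 2 ^ N)) (mirror N (b % 2 ^ N))
      ≡⟨ lcp-mirror N (m%n<n a (2 ^ N)) (m%n<n b (2 ^ N)) ⟩
    lcp N (b % 2 ^ N) (a % 2 ^ N) ∎

δ-min : ∀ N {u v w} → u ≤ v → v ≤ w → δ N u w ≡ δ N u v ⊓ δ N v w
δ-min N u≤v v≤w = cong suc (lcp-min N u≤v v≤w)

δ-widenʳ : ∀ N {u v w} → u ≤ v → v ≤ w → δ N u w ≤ δ N u v
δ-widenʳ N {u} {v} {w} u≤v v≤w = subst (_≤ δ N u v) (sym (δ-min N u≤v v≤w)) (m⊓n≤m _ _)

δ-widenˡ : ∀ N {u v w} → u ≤ v → v ≤ w → δ N u w ≤ δ N v w
δ-widenˡ N {u} {v} {w} u≤v v≤w = subst (_≤ δ N v w) (sym (δ-min N u≤v v≤w)) (m⊓n≤n _ _)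

δ-outer : ∀ N {u v w} → u ≤ v → v ≤ w → δ N v w < δ N u v → δ N u w ≡ δ N v w
δ-outer N u≤v v≤w vw<uv = trans (δ-min N u≤v v≤w) (m≥n⇒m⊓n≡n (<⇒≤ vw<uv))

δ-≢ : ∀ N {u v w} → u < v → v < w → w < 2 ^ N → δ N u v ≢ δ N v w
δ-≢ N u<v v<w w<2^N eq = lcp-≢ N u<v v<w w<2^N (suc-injective eq)

δ-mirror : ∀ N {a b} → a < 2 ^ N → b < 2 ^ N → δ N (mirror N a) (mirror N b) ≡ δ N b a
δ-mirror N a<2^N b<2^N = cong suc (lcp-mirror N a<2^N b<2^N)

3∸[3∸toℕ]≡toℕ : (x : Fin 2) → 3 ∸ (3 ∸ toℕ x) ≡ toℕ x
3∸[3∸toℕ]≡toℕ zero       = refl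
3∸[3∸toℕ]≡toℕ (suc zero) = refl

3∸toℕ≢toℕ : (x y : Fin 2) → 3 ∸ toℕ x ≢ toℕ y
3∸toℕ≢toℕ zero       zero       ()
3∸toℕ≢toℕ zero       (suc zero) ()
3∸toℕ≢toℕ (suc zero) zero       ()
3∸toℕ≢toℕ (suc zero) (suc zero) ()

combColour : Col2 → ℕ → ℕ → ℕ
combColour c d₁ d₂ = if d₂ <ᵇ d₁ then toℕ (c d₂ d₁) else 3 ∸ toℕ (c d₁ d₂)

combColour-left : ∀ c {d₁ d₂} → d₂ < d₁ → combColour c d₁ d₂ ≡ toℕ (c d₂ d₁)
combColour-left c {d₁} {d₂} d₂<d₁ with d₂ <ᵇ d₁ | <⇒<ᵇ d₂<d₁
... | true | _ = refl

combColour-right : ∀ c {d₁ d₂} → d₁ < d₂ → combColour c d₁ d₂ ≡ 3 ∸ toℕ (c d₁ d₂)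
combColour-right c {d₁} {d₂} d₁<d₂ with d₂ <ᵇ d₁ | <ᵇ⇒< d₂ d₁
... | false | _       = refl
... | true  | d₂<ᵇd₁ = ⊥-elim (<-asym d₁<d₂ (d₂<ᵇd₁ tt))

combColour-swap : ∀ c {d₁ d₂} → d₁ ≢ d₂ → combColour c d₂ d₁ ≡ 3 ∸ combColour c d₁ d₂
combColour-swap c {d₁} {d₂} d₁≢d₂ with <-cmp d₁ d₂
... | tri< d₁<d₂ _ _ = begin
  combColour c d₂ d₁           ≡⟨ combColour-left c d₁<d₂ ⟩
  toℕ (c d₁ d₂)                ≡⟨ 3∸[3∸toℕ]≡toℕ (c d₁ d₂) ⟨
  3 ∸ (3 ∸ toℕ (c d₁ d₂))      ≡⟨ cong (3 ∸_) (combColour-right c d₁<d₂) ⟨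
  3 ∸ combColour c d₁ d₂       ∎
  where open ≡-Reasoning
... | tri≈ _ d₁≡d₂ _ = ⊥-elim (d₁≢d₂ d₁≡d₂)
... | tri> _ _ d₂<d₁ =
  trans (combColour-right c d₂<d₁) (cong (3 ∸_) (sym (combColour-left c d₂<d₁)))

combColour≡toℕ⇒left : ∀ {c d₁ d₂} γ → combColour c d₁ d₂ ≡ toℕ γ → d₂ < d₁ × c d₂ d₁ ≡ γ
combColour≡toℕ⇒left {c} {d₁} {d₂} γ eq with d₂ <ᵇ d₁ in d₂<ᵇd₁
... | true  = <ᵇ⇒< d₂ d₁ (subst T (sym d₂<ᵇd₁) tt) , toℕ-injective eq
... | false = ⊥-elim (3∸toℕ≢toℕ (c d₁ d₂) γ eq)

χ-mirror : ∀ N c {a b d} → a < b → b < d → d < 2 ^ N →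
  χ N c (mirror N d) (mirror N b) (mirror N a) ≡ 3 ∸ χ N c a b d
χ-mirror N c {a} {b} {d} a<b b<d d<2^N = begin
  χ N c (mirror N d) (mirror N b) (mirror N a)
    ≡⟨ cong₂ (combColour c) (δ-mirror N d<2^N b<2^N) (δ-mirror N b<2^N a<2^N) ⟩
  combColour c (δ N b d) (δ N a b)
    ≡⟨ combColour-swap c (δ-≢ N a<b b<d d<2^N) ⟩
  3 ∸ χ N c a b d ∎
  where
  open ≡-Reasoning
  b<2^N : b < 2 ^ N
  b<2^N = <-trans b<d d<2^N
  a<2^N : a < 2 ^ N
  a<2^N = <-trans a<b b<2^N

strictMonoOn⇒monoOn : ∀ {P : ℕ → Set} {f : ℕ → ℕ} →
  (∀ u v → P u → P v → u < v → f u < f v) → ∀ {u v} → P u → P v → u ≤ v → f u ≤ f v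
strictMonoOn⇒monoOn f-mono Pu Pv u≤v with m≤n⇒m<n∨m≡n u≤v
... | inj₁ u<v  = <⇒≤ (f-mono _ _ Pu Pv u<v)
... | inj₂ refl = ≤-refl

module _ {n : ℕ} (F : FMember n) where
  open FMember F

  x-vertex : ∀ {i} → i ≤ n → IsVertex F (x i)
  x-vertex {i} i≤n = inj₁ (i , i≤n , refl)

  xJ-vertex : ∀ {j j'} → ValidJ n j j' → IsVertex F (xJ j j')
  xJ-vertex {j} {j'} J = inj₂ (j , j' , J , refl)

  x-mono-≤ : ∀ {i j} → i ≤ j → j ≤ n → x i ≤ x j
  x-mono-≤ i≤j j≤n =
    strictMonoOn⇒monoOn (λ i j _ j≤n i<j → x-mono i j i<j j≤n) (≤-trans i≤j j≤n) j≤n i≤j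

  xJ<x : ∀ {j j' i} → ValidJ n j j' → 2 ≤ i → i ≤ n → xJ j j' < x i
  xJ<x {j} {j'} {i} J 2≤i i≤n = ≤-<-trans (xJ-hi j j' J) (x-mono 1 i 2≤i i≤n)

chain⇒monoClique : ∀ {N n t c} (γ : Fin 2) (E : ℕ → ℕ) → t < n →
  (∀ p → 2 ≤ p → p ≤ n → 1 ≤ E p × E p ≤ N) →
  (∀ p q → 2 ≤ p → p < q → q ≤ n → E q < E p × c (E q) (E p) ≡ γ) →
  MonoClique N t c γ
chain⇒monoClique {N} {n} {t} {c} γ E t<n E-bounded E-chain =
  (λ i → E (n ∸ i)) , (λ i i<t → E-bounded (n ∸ i) (2≤n∸i i<t) (m∸n≤m n i))
                    , (λ i j i<j j<t → proj₁ (pair i<j j<t))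
                    , (λ i j i<j j<t → proj₂ (pair i<j j<t))
  where
  2≤n∸i : ∀ {i} → i < t → 2 ≤ n ∸ i
  2≤n∸i i<t = m+n≤o⇒m≤o∸n 2 (≤-trans (s≤s i<t) t<n)

  pair : ∀ {i j} → i < j → j < t → E (n ∸ i) < E (n ∸ j) × c (E (n ∸ i)) (E (n ∸ j)) ≡ γ
  pair {i} {j} i<j j<t =
    E-chain (n ∸ j) (n ∸ i) (2≤n∸i j<t) (∸-monoʳ-< i<j (<⇒≤ (<-trans j<t t<n))) (m∸n≤m n i)

monoCopy⇒monoClique : ∀ {N n t c} (F : FMember n) (γ : Fin 2) → t < n →
  MonoCopy F N c (toℕ γ) → MonoClique N t c γ
monoCopy⇒monoClique {N} {n} {t} {c} F γ t<n (φ , φ<2^N , φ-mono , edgeI , edgeJ) =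
  chain⇒monoClique {c = c} γ (λ p → δ N (a 1) (a p)) t<n level-bounded level-chain
  where
  open FMember F

  a : ℕ → ℕ
  a i = φ (x i)

  φ-mono-≤ : ∀ {u v} → IsVertex F u → IsVertex F v → u ≤ v → φ u ≤ φ v
  φ-mono-≤ = strictMonoOn⇒monoOn φ-mono

  a-mono : ∀ {i j} → i < j → j ≤ n → a i < a j
  a-mono {i} {j} i<j j≤n =
    φ-mono _ _ (x-vertex F (≤-trans (<⇒≤ i<j) j≤n)) (x-vertex F j≤n) (x-mono i j i<j j≤n)

  a-mono-≤ : ∀ {i j} → i ≤ j → j ≤ n → a i ≤ a j
  a-mono-≤ i≤j j≤n = φ-mono-≤ (x-vertex F (≤-trans i≤j j≤n)) (x-vertex F j≤n) (x-mono-≤ F i≤j j≤n)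

  level-bounded : ∀ p → 2 ≤ p → p ≤ n → 1 ≤ δ N (a 1) (a p) × δ N (a 1) (a p) ≤ N
  level-bounded p 2≤p p≤n = s≤s z≤n , lcp-< N (a-mono 2≤p p≤n) (φ<2^N _ (x-vertex F p≤n))

  level-chain : ∀ p q → 2 ≤ p → p < q → q ≤ n →
    δ N (a 1) (a q) < δ N (a 1) (a p) × c (δ N (a 1) (a q)) (δ N (a 1) (a p)) ≡ γ
  level-chain p q 2≤p p<q q≤n =
    subst₂ (λ e e' → e < e' × c e e' ≡ γ) (sym a₁a_q≡a_pa_q) ya_p≡a₁a_p leftJ
    where
    open ≤-Reasoning
    valid : ValidJ n p q
    valid = 2≤p , p<q , q≤n
    p≤n : p ≤ n
    p≤n = ≤-trans (<⇒≤ p<q) q≤n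
    2≤n : 2 ≤ n
    2≤n = ≤-trans 2≤p p≤n
    y : ℕ
    y = φ (xJ p q)
    leftI : δ N (a 1) (a 2) < δ N (a 0) (a 1) × c (δ N (a 1) (a 2)) (δ N (a 0) (a 1)) ≡ γ
    leftI = combColour≡toℕ⇒left {c} γ edgeI
    leftJ : δ N (a p) (a q) < δ N y (a p) × c (δ N (a p) (a q)) (δ N y (a p)) ≡ γ
    leftJ = combColour≡toℕ⇒left {c} γ (edgeJ p q valid)
    a₀≤y : a 0 ≤ y
    a₀≤y = φ-mono-≤ (x-vertex F z≤n) (xJ-vertex F valid) (xJ-lo p q valid)
    y≤a₁ : y ≤ a 1
    y≤a₁ = φ-mono-≤ (xJ-vertex F valid) (x-vertex F (≤-trans (s≤s z≤n) 2≤n)) (xJ-hi p q valid)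
    a₁≤a_p : a 1 ≤ a p
    a₁≤a_p = <⇒≤ (a-mono 2≤p p≤n)
    a₁a_p<ya₁ : δ N (a 1) (a p) < δ N y (a 1)
    a₁a_p<ya₁ = begin-strict
      δ N (a 1) (a p) ≤⟨ δ-widenʳ N (a-mono-≤ (s≤s z≤n) 2≤n) (a-mono-≤ 2≤p p≤n) ⟩
      δ N (a 1) (a 2) <⟨ proj₁ leftI ⟩
      δ N (a 0) (a 1) ≤⟨ δ-widenˡ N a₀≤y y≤a₁ ⟩
      δ N y (a 1)     ∎
    ya_p≡a₁a_p : δ N y (a p) ≡ δ N (a 1) (a p)
    ya_p≡a₁a_p = δ-outer N y≤a₁ a₁≤a_p a₁a_p<ya₁
    a₁a_q≡a_pa_q : δ N (a 1) (a q) ≡ δ N (a p) (a q)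
    a₁a_q≡a_pa_q = δ-outer N a₁≤a_p (a-mono-≤ (<⇒≤ p<q) q≤n)
                     (subst (δ N (a p) (a q) <_) ya_p≡a₁a_p (proj₁ leftJ))

monoCopyRev⇒monoCopy : ∀ {N n c} (F : FMember n) (γ : Fin 2) → 2 ≤ n →
  MonoCopyRev F N c (3 ∸ toℕ γ) → MonoCopy F N c (toℕ γ)
monoCopyRev⇒monoCopy {N} {n} {c} F γ 2≤n (φ , φ<2^N , φ-antitone , edgeI , edgeJ) =
  mirror N ∘ φ
  , (λ v v∈F → mirror-< N (φ<2^N v v∈F))
  , (λ u v u∈F v∈F u<v → mirror-reverses N (φ-antitone u v u∈F v∈F u<v) (φ<2^N u u∈F))
  , mirrored (x-vertex F z≤n) (x-vertex F 1≤n) (x-vertex F 2≤n)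
             (x-mono 0 1 z<s 1≤n) (x-mono 1 2 ≤-refl 2≤n) edgeI
  , λ j j' J@(2≤j , j<j' , j'≤n) →
      let j≤n = ≤-trans (<⇒≤ j<j') j'≤n in
      mirrored (xJ-vertex F J) (x-vertex F j≤n) (x-vertex F j'≤n)
               (xJ<x F J 2≤j j≤n) (x-mono j j' j<j' j'≤n) (edgeJ j j' J)
  where
  open FMember F
  1≤n : 1 ≤ n
  1≤n = ≤-trans (s≤s z≤n) 2≤n
  mirrored : ∀ {u v w} → IsVertex F u → IsVertex F v → IsVertex F w → u < v → v < w →
    χ N c (φ w) (φ v) (φ u) ≡ 3 ∸ toℕ γ →
    χ N c (mirror N (φ u)) (mirror N (φ v)) (mirror N (φ w)) ≡ toℕ γ
  mirrored {u} {v} {w} u∈F v∈F w∈F u<v v<w edge = begin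
    χ N c (mirror N (φ u)) (mirror N (φ v)) (mirror N (φ w))
      ≡⟨ χ-mirror N c (φ-antitone v w v∈F w∈F v<w) (φ-antitone u v u∈F v∈F u<v) (φ<2^N u u∈F) ⟩
    3 ∸ χ N c (φ w) (φ v) (φ u) ≡⟨ cong (3 ∸_) edge ⟩
    3 ∸ (3 ∸ toℕ γ)             ≡⟨ 3∸[3∸toℕ]≡toℕ γ ⟩
    toℕ γ                       ∎
    where open ≡-Reasoning

proposition2p9 : (N n t : ℕ) → 1 ≤ t → t < n → n ≤ N → 3 ≤ n →
    (c : Col2) → (∀ (α : Fin 2) → ¬ MonoClique N t c α) →
    ((F : FMember n) → ¬ MonoCopy F N c 0 × ¬ MonoCopy F N c 1) ×
    ((F : FMember n) → ¬ MonoCopyRev F N c 2 × ¬ MonoCopyRev F N c 3)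
proposition2p9 N n t _ t<n _ 3≤n c noClique =
  (λ F → noCopy F zero , noCopy F (suc zero)) ,
  (λ F → noCopy F (suc zero) ∘ monoCopyRev⇒monoCopy {N} {c = c} F (suc zero) 2≤n
       , noCopy F zero ∘ monoCopyRev⇒monoCopy {N} {c = c} F zero 2≤n)
  where
  noCopy : (F : FMember n) (γ : Fin 2) → ¬ MonoCopy F N c (toℕ γ)
  noCopy F γ = noClique γ ∘ monoCopy⇒monoClique {N} {c = c} F γ t<n
  2≤n : 2 ≤ n
  2≤n = ≤-trans (n≤1+n 2) 3≤n
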